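{- Let $\mathcal{H}$ be a disconnected hypergraph with components $\mathcal{H}_1,\dots,\mathcal{H}_\ell$ ($\ell\ge2$) indexed so that $w_M^M(\mathcal{H}_1)\le\dots\le w_M^M(\mathcal{H}_\ell)$. Then $w_M^M(\mathcal{H})=w_M^M(\mathcal{H}_1)$ and $w_M^M(\mathcal{H}_1)\le w_M^B(\mathcal{H})\le w_M^M(\mathcal{H}_2)$.
   Context: A hypergraph $\mathcal{H}$ has a finite vertex set $V(\mathcal{H})$ and a set $E(\mathcal{H})$ of nonempty subsets of $V(\mathcal{H})$ (edges); its components are the maximal connected subhypergraphs (vertices linked by chains of edges). In the Maker-Breaker game on $\mathcal{H}$, Maker and Breaker alternately play a vertex not played before; Maker wins as soon as he has played all vertices of some edge, and Breaker wins as soon as her played vertices meet every edge. In the Maker-start (resp. Breaker-start) game Maker (resp. Breaker) moves first. $w_M^M(\mathcal{H})$ (resp. $w_M^B(\mathcal{H})$) is the minimum number of his own moves by which Maker can force a win in the Maker-start (resp. Breaker-start) game, against a Breaker who tries to maximize it; it is $\infty$ if Maker cannot force a win. -}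

module Defs where

open import Data.Nat using (ℕ; zero; suc; _≤_)
open import Data.Bool using (Bool; true; false; if_then_else_; not; _∧_; _∨_)
open import Data.Fin using (Fin)
open import Data.Fin.Subset using (Subset; ⊥; ⁅_⁆; _∪_; _∈_; _⊆_; Nonempty)
open import Data.List using (List; []; _∷_; filter; map; foldr)
open import Data.Bool.ListAction using (any; all)
open import Data.List.Base using (allFin)
open import Data.List.Relation.Unary.All using (All)
open import Data.Vec using (Vec; []; _∷_; lookup)
open import Data.Product using (_×_; Σ; ∃)
open import Relation.Binary.PropositionalEquality using (_≡_)
import Data.List.Membership.Propositional as LM

data ℕ∞ : Set where
  fin : ℕ → ℕ∞
  ∞   : ℕ∞

data _≤∞_ : ℕ∞ → ℕ∞ → Set where
  fin≤fin : ∀ {m n} → m ≤ n → fin m ≤∞ fin n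
  _≤∞∞    : ∀ x → x ≤∞ ∞

suc∞ : ℕ∞ → ℕ∞
suc∞ (fin n) = fin (suc n)
suc∞ ∞       = ∞

min∞ : ℕ∞ → ℕ∞ → ℕ∞
min∞ (fin zero)    _             = fin zero
min∞ (fin (suc m)) (fin zero)    = fin zero
min∞ (fin (suc m)) (fin (suc n)) = suc∞ (min∞ (fin m) (fin n))
min∞ (fin m)       ∞             = fin m
min∞ ∞             y             = y

max∞ : ℕ∞ → ℕ∞ → ℕ∞
max∞ (fin zero)    y             = y
max∞ (fin (suc m)) (fin zero)    = fin (suc m)
max∞ (fin (suc m)) (fin (suc n)) = suc∞ (max∞ (fin m) (fin n))
max∞ (fin m)       ∞             = ∞
max∞ ∞             y             = ∞

minimum∞ : List ℕ∞ → ℕ∞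
minimum∞ = foldr min∞ ∞

maximum∞ : List ℕ∞ → ℕ∞
maximum∞ = foldr max∞ (fin 0)

record Hypergraph (n : ℕ) : Set where
  field
    V : Subset n
    E : List (Subset n)
    edges-nonempty : All Nonempty E
    edges-in-V     : All (_⊆ V) E
open Hypergraph public

data Linked {n} (H : Hypergraph n) : Fin n → Fin n → Set where
  here : ∀ {u} → u ∈ V H → Linked H u u
  step : ∀ {u w v} (e : Subset n) → e LM.∈ E H → u ∈ e → w ∈ e →
         Linked H w v → Linked H u v

-- K is a component of H: a maximal connected subhypergraph, i.e. its
-- vertex set is a (nonempty) equivalence class of Linked H, and its
-- edges are exactly the edges of H contained in that class.
record IsComponent {n} (H : Hypergraph n) (K : Hypergraph n) : Set where
  field
    nonempty  : Nonempty (V K)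
    sub       : V K ⊆ V H
    class     : ∀ {u v} → u ∈ V K → (v ∈ V K → Linked H u v) × (Linked H u v → v ∈ V K)
    edges     : ∀ e → (e LM.∈ E K → e LM.∈ E H × e ⊆ V K) × (e LM.∈ E H × e ⊆ V K → e LM.∈ E K)

-- The Maker-Breaker game, positions given by Maker's set M and Breaker's
-- set B of played vertices.

private
  subsetᵇ : ∀ {n} → Subset n → Subset n → Bool
  subsetᵇ []       []       = true
  subsetᵇ (a ∷ as) (b ∷ bs) = (not a ∨ b) ∧ subsetᵇ as bs

  meetsᵇ : ∀ {n} → Subset n → Subset n → Bool
  meetsᵇ []       []       = false
  meetsᵇ (a ∷ as) (b ∷ bs) = (a ∧ b) ∨ meetsᵇ as bs

makerWonᵇ : ∀ {n} → Hypergraph n → Subset n → Bool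
makerWonᵇ H M = any (λ e → subsetᵇ e M) (E H)

breakerWonᵇ : ∀ {n} → Hypergraph n → Subset n → Bool
breakerWonᵇ H B = all (λ e → meetsᵇ e B) (E H)

free : ∀ {n} → Hypergraph n → Subset n → Subset n → List (Fin n)
free H M B = filter (λ v → Data.Bool.T? (lookup (V H) v ∧ not (lookup M v) ∧ not (lookup B v))) (allFin _)
  where import Data.Bool

mutual
  -- number of further Maker moves Maker needs to force a win, Maker to move
  -- (fuel bounds the remaining number of moves)
  valMaker : ∀ {n} → Hypergraph n → ℕ → Subset n → Subset n → ℕ∞
  valMaker H fuel M B =
    if makerWonᵇ H M then fin 0 else
    if breakerWonᵇ H B then ∞ else
    stepMaker H fuel M B

  stepMaker : ∀ {n} → Hypergraph n → ℕ → Subset n → Subset n → ℕ∞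
  stepMaker H zero    M B = ∞
  stepMaker H (suc f) M B =
    suc∞ (minimum∞ (map (λ v → valBreaker H f (M ∪ ⁅ v ⁆) B) (free H M B)))

  valBreaker : ∀ {n} → Hypergraph n → ℕ → Subset n → Subset n → ℕ∞
  valBreaker H fuel M B =
    if makerWonᵇ H M then fin 0 else
    if breakerWonᵇ H B then ∞ else
    stepBreaker H fuel M B

  stepBreaker : ∀ {n} → Hypergraph n → ℕ → Subset n → Subset n → ℕ∞
  stepBreaker H zero    M B = ∞
  stepBreaker H (suc f) M B =
    maximum∞ (map (λ v → valMaker H f M (B ∪ ⁅ v ⁆)) (free H M B))

-- w_M^M and w_M^B (fuel n suffices: at most n moves are ever played)
wMM : ∀ {n} → Hypergraph n → ℕ∞
wMM {n} H = valMaker H n ⊥ ⊥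

wMB : ∀ {n} → Hypergraph n → ℕ∞
wMB {n} H = valBreaker H n ⊥ ⊥

-- Maker, moving first on H, may play an optimal strategy for the component H₁ and simply
-- ignore Breaker's moves in other components.  An extra Breaker move never helps Maker, so w_M^M(H) ≤ w_M^B(H);
-- and Breaker's first move avoids H₁ or H₂, leaving Maker a Maker-start game on an untouched
-- component, won within w_M^M(H₂) moves.
module Submission where

open import Defs
open import Data.Nat using (ℕ; zero; suc; _≤_; _<_; z≤n; s≤s)
open import Data.Nat.Properties using (≤-trans; ≤-antisym; ≤-refl; ≤-pred; <-≤-trans; n≮0)
open import Data.Bool using (Bool; true; false; not; _∧_; _∨_; T; T?; if_then_else_)
open import Data.Bool.Properties using (T-≡; T-not-≡; T-∧; T-∨; ¬-not)
open import Data.Empty using (⊥-elim)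
open import Data.Fin using (Fin; zero; suc; toℕ)
open import Data.Fin.Properties using (_≟_)
open import Data.Fin.Subset
  using (Subset; inside; outside; _∈_; _∉_; _⊆_; _∪_; _∩_; ∁; ⁅_⁆; ∣_∣; Nonempty; Empty)
  renaming (⊥ to ∅)
open import Data.Fin.Subset.Properties
  using ( _∈?_; nonempty?; x∈∁p⇒x∉p; x∉p⇒x∈∁p; ⊆-refl; ⊆-antisym; drop-∷-⊆; x∈⁅x⁆; x∈⁅y⁆⇒x≡y; ∉⊥
        ; x∈p∪q⁺; x∈p∪q⁻; p⊆p∪q; x∈p∩q⁺; x∈p∩q⁻; ∪-assoc; ∪-comm; ∣p∣≤n; p⊂q⇒∣p∣<∣q∣; p⊂q⇒∁p⊃∁q)
open import Data.List using ([]; _∷_; allFin)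
open import Data.List.Relation.Unary.Any as Any using (Any)
open import Data.List.Relation.Unary.Any.Properties as Anyₚ using (any⇔)
open import Data.List.Relation.Unary.All as All using (All; []; _∷_)
open import Data.List.Relation.Unary.All.Properties as Allₚ using (all⁺; all⁻; ¬All⇒Any¬)
open import Data.List.Membership.Propositional using (find; lose) renaming (_∈_ to _∈ₗ_)
open import Data.List.Membership.Propositional.Properties using (∈-filter⁺; ∈-filter⁻; ∈-allFin)
open import Data.Product using (_×_; _,_; proj₁; proj₂; ∃; uncurry)
import Data.Product as Product
open import Data.Sum using (_⊎_; inj₁; inj₂; [_,_]′)
import Data.Sum as Sum
open import Data.Vec using ([]; _∷_; lookup; here; there)
open import Data.Vec.Properties using ([]=⇒lookup; lookup⇒[]=)
open import Function using (_∘_; id; const; flip)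
open import Function.Bundles using (_⇔_; mk⇔; Equivalence)
open import Function.Construct.Composition using (_⇔-∘_)
open import Relation.Binary.PropositionalEquality
  using (_≡_; _≢_; refl; sym; cong; subst; module ≡-Reasoning)
open import Relation.Nullary using (¬_; Dec; yes; no; contradiction; _because_; ¬?; _×-dec_)
open import Relation.Nullary.Decidable using (decidable-stable)
open import Relation.Nullary.Reflects using (Reflects; ofʸ; ofⁿ; fromEquivalence)

open Equivalence using (to; from)

private
  variable
    n m k : ℕ
    x y : ℕ∞
    M B M′ B′ : Subset n

-- Extended naturals

≤∞-trans : ∀ {x y z} → x ≤∞ y → y ≤∞ z → x ≤∞ z
≤∞-trans (fin≤fin p) (fin≤fin q) = fin≤fin (≤-trans p q)
≤∞-trans {x} _ (_ ≤∞∞) = x ≤∞∞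

≤∞-antisym : x ≤∞ y → y ≤∞ x → x ≡ y
≤∞-antisym (fin≤fin p) (fin≤fin q) = cong fin (≤-antisym p q)
≤∞-antisym (∞ ≤∞∞) _ = refl

≤∞-by-fin : (∀ {m} → y ≤∞ fin m → x ≤∞ fin m) → x ≤∞ y
≤∞-by-fin {y = fin m} below = below (fin≤fin ≤-refl)
≤∞-by-fin {y = ∞} {x} _ = x ≤∞∞

suc∞-≤⇔ : suc∞ x ≤∞ fin (suc k) ⇔ x ≤∞ fin k
suc∞-≤⇔ {fin m} = mk⇔ (λ { (fin≤fin (s≤s p)) → fin≤fin p }) (λ { (fin≤fin p) → fin≤fin (s≤s p) })
suc∞-≤⇔ {∞} = mk⇔ (λ ()) (λ ())

suc∞≰fin0 : ¬ suc∞ x ≤∞ fin 0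
suc∞≰fin0 {fin m} (fin≤fin ())

min∞-≤⁻ : ∀ x y → min∞ x y ≤∞ fin k → x ≤∞ fin k ⊎ y ≤∞ fin k
min∞-≤⁻ (fin zero) y p = inj₁ p
min∞-≤⁻ (fin (suc m)) (fin zero) p = inj₂ p
min∞-≤⁻ {zero} (fin (suc m)) (fin (suc n)) p = contradiction p suc∞≰fin0
min∞-≤⁻ {suc k} (fin (suc m)) (fin (suc n)) p =
  Sum.map (from suc∞-≤⇔) (from suc∞-≤⇔) (min∞-≤⁻ (fin m) (fin n) (to suc∞-≤⇔ p))
min∞-≤⁻ (fin (suc m)) ∞ p = inj₁ p
min∞-≤⁻ ∞ y p = inj₂ p

min∞-≤⁺ : ∀ x y → x ≤∞ fin k ⊎ y ≤∞ fin k → min∞ x y ≤∞ fin k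
min∞-≤⁺ (fin zero) y _ = fin≤fin z≤n
min∞-≤⁺ (fin (suc m)) (fin zero) _ = fin≤fin z≤n
min∞-≤⁺ {zero} (fin (suc m)) (fin (suc n)) (inj₁ (fin≤fin ()))
min∞-≤⁺ {zero} (fin (suc m)) (fin (suc n)) (inj₂ (fin≤fin ()))
min∞-≤⁺ {suc k} (fin (suc m)) (fin (suc n)) p =
  from suc∞-≤⇔ (min∞-≤⁺ (fin m) (fin n) (Sum.map (to suc∞-≤⇔) (to suc∞-≤⇔) p))
min∞-≤⁺ (fin (suc m)) ∞ (inj₁ p) = p
min∞-≤⁺ ∞ y (inj₂ p) = p

max∞-≤⁻ : ∀ x y → max∞ x y ≤∞ fin k → x ≤∞ fin k × y ≤∞ fin k
max∞-≤⁻ (fin zero) y p = fin≤fin z≤n , p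
max∞-≤⁻ (fin (suc m)) (fin zero) p = p , fin≤fin z≤n
max∞-≤⁻ {zero} (fin (suc m)) (fin (suc n)) p = contradiction p suc∞≰fin0
max∞-≤⁻ {suc k} (fin (suc m)) (fin (suc n)) p =
  Product.map (from suc∞-≤⇔) (from suc∞-≤⇔) (max∞-≤⁻ (fin m) (fin n) (to suc∞-≤⇔ p))

max∞-≤⁺ : ∀ x y → x ≤∞ fin k → y ≤∞ fin k → max∞ x y ≤∞ fin k
max∞-≤⁺ (fin zero) y _ q = q
max∞-≤⁺ (fin (suc m)) (fin zero) p _ = p
max∞-≤⁺ {zero} (fin (suc m)) (fin (suc n)) (fin≤fin ()) _
max∞-≤⁺ {suc k} (fin (suc m)) (fin (suc n)) p q =
  from suc∞-≤⇔ (max∞-≤⁺ (fin m) (fin n) (to suc∞-≤⇔ p) (to suc∞-≤⇔ q))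

minimum∞-≤⇔ : ∀ xs → minimum∞ xs ≤∞ fin k ⇔ Any (_≤∞ fin k) xs
minimum∞-≤⇔ xs = mk⇔ (⁻ xs) (⁺ xs)
  where
  ⁻ : ∀ xs → minimum∞ xs ≤∞ fin k → Any (_≤∞ fin k) xs
  ⁻ (x ∷ xs) p = [ Any.here , Any.there ∘ ⁻ xs ]′ (min∞-≤⁻ x _ p)
  ⁺ : ∀ xs → Any (_≤∞ fin k) xs → minimum∞ xs ≤∞ fin k
  ⁺ (x ∷ xs) (Any.here p) = min∞-≤⁺ x _ (inj₁ p)
  ⁺ (x ∷ xs) (Any.there p) = min∞-≤⁺ x _ (inj₂ (⁺ xs p))

maximum∞-≤⇔ : ∀ xs → maximum∞ xs ≤∞ fin k ⇔ All (_≤∞ fin k) xs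
maximum∞-≤⇔ xs = mk⇔ (⁻ xs) (⁺ xs)
  where
  ⁻ : ∀ xs → maximum∞ xs ≤∞ fin k → All (_≤∞ fin k) xs
  ⁻ [] _ = []
  ⁻ (x ∷ xs) p = let p₁ , p₂ = max∞-≤⁻ x _ p in p₁ ∷ ⁻ xs p₂
  ⁺ : ∀ xs → All (_≤∞ fin k) xs → maximum∞ xs ≤∞ fin k
  ⁺ [] [] = fin≤fin z≤n
  ⁺ (x ∷ xs) (p ∷ ps) = max∞-≤⁺ x _ p (⁺ xs ps)

-- Won positions and free vertices

MakerHasWon : Hypergraph n → Subset n → Set
MakerHasWon H M = Any (_⊆ M) (E H)

BreakerHasWon : Hypergraph n → Subset n → Set
BreakerHasWon H B = All (λ e → Nonempty (e ∩ B)) (E H)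

-- Defs keeps its per-edge tests private; each is recovered as the test of the
-- hypergraph whose single edge is e enlarged by a fresh vertex 0.
private
  singleEdge : Subset n → Hypergraph (suc n)
  singleEdge e = record
    { V = inside ∷ e ; E = (inside ∷ e) ∷ []
    ; edges-nonempty = (zero , here) ∷ [] ; edges-in-V = ⊆-refl ∷ [] }

  _⊆ᵇ_ : Subset n → Subset n → Bool
  e ⊆ᵇ M = makerWonᵇ (singleEdge e) (inside ∷ M)

  _meetsᵇ_ : Subset n → Subset n → Bool
  e meetsᵇ B = breakerWonᵇ (singleEdge e) (outside ∷ B)

  ⊆ᵇ-sound : ∀ (e M : Subset n) → T (e ⊆ᵇ M) → e ⊆ M
  ⊆ᵇ-sound (outside ∷ e) (_ ∷ M) t (there x∈e) = there (⊆ᵇ-sound e M t x∈e)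
  ⊆ᵇ-sound (inside ∷ e) (inside ∷ M) t here = here
  ⊆ᵇ-sound (inside ∷ e) (inside ∷ M) t (there x∈e) = there (⊆ᵇ-sound e M t x∈e)
  ⊆ᵇ-sound (inside ∷ e) (outside ∷ M) () _

  ⊆ᵇ-complete : ∀ (e M : Subset n) → e ⊆ M → T (e ⊆ᵇ M)
  ⊆ᵇ-complete [] [] _ = _
  ⊆ᵇ-complete (outside ∷ e) (_ ∷ M) e⊆M = ⊆ᵇ-complete e M (drop-∷-⊆ e⊆M)
  ⊆ᵇ-complete (inside ∷ e) (inside ∷ M) e⊆M = ⊆ᵇ-complete e M (drop-∷-⊆ e⊆M)
  ⊆ᵇ-complete (inside ∷ e) (outside ∷ M) e⊆M = contradiction (e⊆M here) λ ()

  meetsᵇ-sound : ∀ (e B : Subset n) → T (e meetsᵇ B) → Nonempty (e ∩ B)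
  meetsᵇ-sound [] [] ()
  meetsᵇ-sound (inside ∷ e) (inside ∷ B) _ = zero , here
  meetsᵇ-sound (inside ∷ e) (outside ∷ B) t = Product.map suc there (meetsᵇ-sound e B t)
  meetsᵇ-sound (outside ∷ e) (_ ∷ B) t = Product.map suc there (meetsᵇ-sound e B t)

  meetsᵇ-complete : ∀ (e B : Subset n) → Nonempty (e ∩ B) → T (e meetsᵇ B)
  meetsᵇ-complete (inside ∷ e) (inside ∷ B) _ = _
  meetsᵇ-complete (inside ∷ e) (outside ∷ B) (suc x , there x∈) = meetsᵇ-complete e B (x , x∈)
  meetsᵇ-complete (outside ∷ e) (_ ∷ B) (suc x , there x∈) = meetsᵇ-complete e B (x , x∈)

  T-∨-false : ∀ {b} → T (b ∨ false) ⇔ T b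
  T-∨-false = mk⇔ [ id , (λ ()) ]′ inj₁ ⇔-∘ T-∨

  T-∧-true : ∀ {b} → T (b ∧ true) ⇔ T b
  T-∧-true = mk⇔ proj₁ (_, _) ⇔-∘ T-∧

makerHasWon-reflects : (H : Hypergraph n) (M : Subset n) → Reflects (MakerHasWon H M) (makerWonᵇ H M)
makerHasWon-reflects H M = fromEquivalence (from won⇔) (to won⇔)
  where
  won⇔ : MakerHasWon H M ⇔ T (makerWonᵇ H M)
  won⇔ = any⇔ ⇔-∘ mk⇔ (Any.map {P = _⊆ M} λ {e} e⊆M → to T-∨-false (⊆ᵇ-complete e M e⊆M))
                        (Any.map {Q = _⊆ M} λ {e} t → ⊆ᵇ-sound e M (from T-∨-false t))

breakerHasWon-reflects : (H : Hypergraph n) (B : Subset n) →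
                         Reflects (BreakerHasWon H B) (breakerWonᵇ H B)
breakerHasWon-reflects H B = fromEquivalence (from won⇔) (to won⇔)
  where
  won⇔ : BreakerHasWon H B ⇔ T (breakerWonᵇ H B)
  won⇔ = mk⇔ (all⁻ _ ∘ All.map λ {e} meets → to T-∧-true (meetsᵇ-complete e B meets))
             (All.map (λ {e} t → meetsᵇ-sound e B (from T-∧-true t)) ∘ all⁺ _ (E H))

makerHasWon? : (H : Hypergraph n) (M : Subset n) → Dec (MakerHasWon H M)
makerHasWon? H M = makerWonᵇ H M because makerHasWon-reflects H M

breakerHasWon? : (H : Hypergraph n) (B : Subset n) → Dec (BreakerHasWon H B)
breakerHasWon? H B = breakerWonᵇ H B because breakerHasWon-reflects H B

makerHasWon⇒¬breakerHasWon : (H : Hypergraph n) → Empty (M ∩ B) → MakerHasWon H M → ¬ BreakerHasWon H B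
makerHasWon⇒¬breakerHasWon {M = M} {B} H disjoint makerWon breakerWon =
  let e , e∈E , e⊆M = find makerWon
      x , x∈e∩B = All.lookup breakerWon e∈E
      x∈e , x∈B = x∈p∩q⁻ e B x∈e∩B
  in disjoint (x , x∈p∩q⁺ (e⊆M x∈e , x∈B))

Free : Hypergraph n → Subset n → Subset n → Fin n → Set
Free H M B v = v ∈ V H × v ∉ M × v ∉ B

free? : (H : Hypergraph n) (M B : Subset n) (v : Fin n) → Dec (Free H M B v)
free? H M B v = v ∈? V H ×-dec ¬? (v ∈? M) ×-dec ¬? (v ∈? B)

∈-free⇔ : ∀ (H : Hypergraph n) {v} → v ∈ₗ free H M B ⇔ Free H M B v
∈-free⇔ {M = M} {B} H {v} = mk⇔
  (λ v∈free → let inV , rest = to T-∧ (proj₂ (∈-filter⁻ isFree? {xs = allFin _} v∈free))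
                  notM , notB = to T-∧ rest
              in to (T-lookup (V H)) inV , to (T-not-lookup M) notM , to (T-not-lookup B) notB)
  (λ { (inV , ∉M , ∉B) → ∈-filter⁺ isFree? (∈-allFin v)
         (from T-∧ (from (T-lookup (V H)) inV ,
                    from T-∧ (from (T-not-lookup M) ∉M , from (T-not-lookup B) ∉B))) })
  where
  isFree? : ∀ u → Dec (T (lookup (V H) u ∧ not (lookup M u) ∧ not (lookup B u)))
  isFree? u = T? _
  T-lookup : ∀ p → T (lookup p v) ⇔ v ∈ p
  T-lookup p = mk⇔ (lookup⇒[]= v p ∘ to T-≡) (from T-≡ ∘ []=⇒lookup)
  T-not-lookup : ∀ p → T (not (lookup p v)) ⇔ v ∉ p
  T-not-lookup p = mk⇔ (λ t v∈p → subst (T ∘ not) ([]=⇒lookup v∈p) t)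
                       (λ v∉p → from T-not-≡ (¬-not (v∉p ∘ lookup⇒[]= v p)))

⊈⇒witness : (p q : Subset n) → ¬ p ⊆ q → ∃ λ x → x ∈ p × x ∉ q
⊈⇒witness p q p⊈q with nonempty? (p ∩ ∁ q)
... | yes (x , x∈p∩∁q) = let x∈p , x∈∁q = x∈p∩q⁻ p (∁ q) x∈p∩∁q in x , x∈p , x∈∁p⇒x∉p x∈∁q
... | no p∩∁q-empty = contradiction
  (λ {x} x∈p → decidable-stable (x ∈? q) λ x∉q → p∩∁q-empty (x , x∈p∩q⁺ (x∈p , x∉p⇒x∈∁p x∉q)))
  p⊈q

x∈p∪⁅y⁆⇒x∈p : ∀ {p : Subset n} {x y} → x ≢ y → x ∈ p ∪ ⁅ y ⁆ → x ∈ p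
x∈p∪⁅y⁆⇒x∈p {p = p} {y = y} x≢y =
  [ id , (λ x∈⁅y⁆ → contradiction (x∈⁅y⁆⇒x≡y y x∈⁅y⁆) x≢y) ]′ ∘ x∈p∪q⁻ p ⁅ y ⁆

undecided⇒free : (H : Hypergraph n) → ¬ MakerHasWon H M → ¬ BreakerHasWon H B → ∃ (Free H M B)
undecided⇒free {M = M} {B} H ¬makerWon ¬breakerWon =
  let e , e∈E , e∩B-empty = find (¬All⇒Any¬ (λ e → nonempty? (e ∩ B)) (E H) ¬breakerWon)
      x , x∈e , x∉M = ⊈⇒witness e M (¬makerWon ∘ lose e∈E)
  in x , All.lookup (edges-in-V H) e∈E x∈e , x∉M , λ x∈B → e∩B-empty (x , x∈p∩q⁺ (x∈e , x∈B))

unplayed : Subset n → Subset n → ℕ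
unplayed M B = ∣ ∁ (M ∪ B) ∣

private
  ∣∁∣-shrinks : ∀ {v} (P : Subset n) → v ∉ P → ∣ ∁ (P ∪ ⁅ v ⁆) ∣ < ∣ ∁ P ∣
  ∣∁∣-shrinks P v∉P = p⊂q⇒∣p∣<∣q∣ (p⊂q⇒∁p⊃∁q (p⊆p∪q _ , _ , x∈p∪q⁺ (inj₂ (x∈⁅x⁆ _)) , v∉P))

  ∉∪ : ∀ {v} → v ∉ M → v ∉ B → v ∉ M ∪ B
  ∉∪ {M = M} {B} v∉M v∉B = [ v∉M , v∉B ]′ ∘ x∈p∪q⁻ M B

unplayed-maker-move : ∀ (H : Hypergraph n) {v} → Free H M B v → unplayed (M ∪ ⁅ v ⁆) B < unplayed M B
unplayed-maker-move {M = M} {B} H {v} (_ , v∉M , v∉B) =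
  subst (λ P → ∣ ∁ P ∣ < unplayed M B) reorder (∣∁∣-shrinks (M ∪ B) (∉∪ v∉M v∉B))
  where
  reorder : (M ∪ B) ∪ ⁅ v ⁆ ≡ (M ∪ ⁅ v ⁆) ∪ B
  reorder = begin
    (M ∪ B) ∪ ⁅ v ⁆   ≡⟨ ∪-assoc M B ⁅ v ⁆ ⟩
    M ∪ (B ∪ ⁅ v ⁆)   ≡⟨ cong (M ∪_) (∪-comm B ⁅ v ⁆) ⟩
    M ∪ (⁅ v ⁆ ∪ B)   ≡⟨ ∪-assoc M ⁅ v ⁆ B ⟨
    (M ∪ ⁅ v ⁆) ∪ B   ∎
    where open ≡-Reasoning

unplayed-breaker-move : ∀ (H : Hypergraph n) {v} → Free H M B v → unplayed M (B ∪ ⁅ v ⁆) < unplayed M B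
unplayed-breaker-move {M = M} {B} H {v} (_ , v∉M , v∉B) =
  subst (λ P → ∣ ∁ P ∣ < unplayed M B) (∪-assoc M B ⁅ v ⁆) (∣∁∣-shrinks (M ∪ B) (∉∪ v∉M v∉B))

-- Win certificates and the game values

-- Winᴹ H m M B: Maker, to move at position (M , B), can force a win within m more moves of his;
-- Winᴮ likewise with Breaker to move.
data Winᴹ (H : Hypergraph n) : ℕ → Subset n → Subset n → Set
data Winᴮ (H : Hypergraph n) : ℕ → Subset n → Subset n → Set

data Winᴹ H where
  won  : MakerHasWon H M → Winᴹ H m M B
  play : ∀ {v} → ¬ BreakerHasWon H B → Free H M B v → Winᴮ H m (M ∪ ⁅ v ⁆) B → Winᴹ H (suc m) M B

data Winᴮ H where
  won     : MakerHasWon H M → Winᴮ H m M B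
  respond : ¬ BreakerHasWon H B → (∀ {v} → Free H M B v → Winᴹ H m M (B ∪ ⁅ v ⁆)) → Winᴮ H m M B

outcome-≤⇔ : ∀ {P Q : Set} {b c} → Reflects P b → Reflects Q c →
             (if b then fin 0 else if c then ∞ else x) ≤∞ fin k ⇔ (P ⊎ ¬ Q × x ≤∞ fin k)
outcome-≤⇔ (ofʸ p) _ = mk⇔ (λ _ → inj₁ p) (λ _ → fin≤fin z≤n)
outcome-≤⇔ (ofⁿ ¬p) (ofʸ q) = mk⇔ (λ ()) [ ⊥-elim ∘ ¬p , (λ (¬q , _) → contradiction q ¬q) ]′
outcome-≤⇔ (ofⁿ ¬p) (ofⁿ ¬q) = mk⇔ (λ x≤k → inj₂ (¬q , x≤k)) [ ⊥-elim ∘ ¬p , proj₂ ]′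

module _ (H : Hypergraph n) where

  private
    valMaker-≤⇔ : ∀ f → valMaker H f M B ≤∞ fin k ⇔
                  (MakerHasWon H M ⊎ ¬ BreakerHasWon H B × stepMaker H f M B ≤∞ fin k)
    valMaker-≤⇔ {M = M} {B} f = outcome-≤⇔ (makerHasWon-reflects H M) (breakerHasWon-reflects H B)

    valBreaker-≤⇔ : ∀ f → valBreaker H f M B ≤∞ fin k ⇔
                    (MakerHasWon H M ⊎ ¬ BreakerHasWon H B × stepBreaker H f M B ≤∞ fin k)
    valBreaker-≤⇔ {M = M} {B} f = outcome-≤⇔ (makerHasWon-reflects H M) (breakerHasWon-reflects H B)

  valMaker-sound : ∀ f → valMaker H f M B ≤∞ fin m → Winᴹ H m M B
  valBreaker-sound : ∀ f → valBreaker H f M B ≤∞ fin m → Winᴮ H m M B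
  stepMaker-sound : ∀ f → ¬ BreakerHasWon H B → stepMaker H f M B ≤∞ fin m → Winᴹ H m M B
  stepBreaker-sound : ∀ f → ¬ BreakerHasWon H B → stepBreaker H f M B ≤∞ fin m → Winᴮ H m M B

  valMaker-sound f val≤m = [ won , uncurry (stepMaker-sound f) ]′ (to (valMaker-≤⇔ f) val≤m)

  valBreaker-sound f val≤m = [ won , uncurry (stepBreaker-sound f) ]′ (to (valBreaker-≤⇔ f) val≤m)

  stepMaker-sound {m = zero} (suc f) _ step≤0 = contradiction step≤0 suc∞≰fin0
  stepMaker-sound {m = suc m} (suc f) ¬breakerWon step≤m =
    let v , v∈free , val≤m = find (Anyₚ.map⁻ (to (minimum∞-≤⇔ _) (to suc∞-≤⇔ step≤m)))
    in play ¬breakerWon (to (∈-free⇔ H) v∈free) (valBreaker-sound f val≤m)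

  stepBreaker-sound (suc f) ¬breakerWon step≤m = respond ¬breakerWon λ v-free →
    valMaker-sound f (All.lookup (Allₚ.map⁻ (to (maximum∞-≤⇔ _) step≤m)) (from (∈-free⇔ H) v-free))

  valMaker-complete : Winᴹ H m M B → ∀ f → unplayed M B ≤ f → valMaker H f M B ≤∞ fin m
  valBreaker-complete : Winᴮ H m M B → ∀ f → unplayed M B ≤ f → valBreaker H f M B ≤∞ fin m

  valMaker-complete (won makerWon) f _ = from (valMaker-≤⇔ f) (inj₁ makerWon)
  valMaker-complete {m = suc m} {M} {B} (play {v = v} ¬breakerWon v-free win) f fuel =
    from (valMaker-≤⇔ f) (inj₂ (¬breakerWon , stepMaker-complete f fuel))
    where
    shrinks : unplayed (M ∪ ⁅ v ⁆) B < unplayed M B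
    shrinks = unplayed-maker-move H v-free
    stepMaker-complete : ∀ f → unplayed M B ≤ f → stepMaker H f M B ≤∞ fin (suc m)
    stepMaker-complete zero fuel = contradiction (<-≤-trans shrinks fuel) n≮0
    stepMaker-complete (suc f) fuel = from suc∞-≤⇔ (from (minimum∞-≤⇔ _) (Anyₚ.map⁺
      (lose (from (∈-free⇔ H) v-free) (valBreaker-complete win f (≤-pred (<-≤-trans shrinks fuel))))))

  valBreaker-complete (won makerWon) f _ = from (valBreaker-≤⇔ f) (inj₁ makerWon)
  valBreaker-complete {m = m} {M} {B} (respond ¬breakerWon wins) f fuel with makerHasWon? H M
  ... | yes makerWon = from (valBreaker-≤⇔ f) (inj₁ makerWon)
  ... | no ¬makerWon = from (valBreaker-≤⇔ f) (inj₂ (¬breakerWon , stepBreaker-complete f fuel))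
    where
    stepBreaker-complete : ∀ f → unplayed M B ≤ f → stepBreaker H f M B ≤∞ fin m
    stepBreaker-complete zero fuel = let _ , v-free = undecided⇒free H ¬makerWon ¬breakerWon in
      contradiction (<-≤-trans (unplayed-breaker-move H v-free) fuel) n≮0
    stepBreaker-complete (suc f) fuel = from (maximum∞-≤⇔ _) (Allₚ.map⁺ (All.tabulate λ v∈free →
      let v-free = to (∈-free⇔ H) v∈free in
      valMaker-complete (wins v-free) f (≤-pred (<-≤-trans (unplayed-breaker-move H v-free) fuel))))

wMM-≤⇔ : (H : Hypergraph n) → wMM H ≤∞ fin m ⇔ Winᴹ H m ∅ ∅
wMM-≤⇔ {n} H = mk⇔ (valMaker-sound H n) (λ win → valMaker-complete H win n (∣p∣≤n (∁ (∅ ∪ ∅))))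

wMB-≤⇔ : (H : Hypergraph n) → wMB H ≤∞ fin m ⇔ Winᴮ H m ∅ ∅
wMB-≤⇔ {n} H = mk⇔ (valBreaker-sound H n) (λ win → valBreaker-complete H win n (∣p∣≤n (∁ (∅ ∪ ∅))))

-- Transferring wins between a hypergraph and its parts

record SubHypergraph (K H : Hypergraph n) : Set where
  field
    vertices⊆ : V K ⊆ V H
    edges⊆    : ∀ {e} → e ∈ₗ E K → e ∈ₗ E H

SubHypergraph-refl : (H : Hypergraph n) → SubHypergraph H H
SubHypergraph-refl H = record { vertices⊆ = id ; edges⊆ = id }

record AsGoodOn (K : Hypergraph n) (M B M′ B′ : Subset n) : Set where
  field
    makers-agree   : ∀ {x} → x ∈ V K → x ∈ M ⇔ x ∈ M′
    breaker-within : ∀ {x} → x ∈ V K → x ∈ B → x ∈ B′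
open AsGoodOn

AsGoodOn-refl : ∀ {K : Hypergraph n} → AsGoodOn K M B M B
AsGoodOn-refl = record { makers-agree = λ _ → mk⇔ id id ; breaker-within = λ _ → id }

AsGoodOn-maker-move : ∀ {K : Hypergraph n} {v} →
                      AsGoodOn K M B M′ B′ → AsGoodOn K (M ∪ ⁅ v ⁆) B (M′ ∪ ⁅ v ⁆) B′
AsGoodOn-maker-move {M = M} {M′ = M′} r = record
  { makers-agree = λ x∈K → mk⇔ (x∈p∪q⁺ ∘ Sum.map₁ (to (makers-agree r x∈K)) ∘ x∈p∪q⁻ M _)
                                (x∈p∪q⁺ ∘ Sum.map₁ (from (makers-agree r x∈K)) ∘ x∈p∪q⁻ M′ _)
  ; breaker-within = breaker-within r }

AsGoodOn-breaker-move : ∀ {K : Hypergraph n} {u w} → AsGoodOn K M B M′ B′ →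
                       (u ∈ V K → u ∈ B′ ∪ ⁅ w ⁆) → AsGoodOn K M (B ∪ ⁅ u ⁆) M′ (B′ ∪ ⁅ w ⁆)
AsGoodOn-breaker-move {B = B} {B′ = B′} {K = K} {u} {w} r u-covered = record
  { makers-agree = makers-agree r
  ; breaker-within = λ x∈K x∈B∪u → case x∈K (x∈p∪q⁻ B ⁅ u ⁆ x∈B∪u) }
  where
  case : ∀ {x} → x ∈ V K → x ∈ B ⊎ x ∈ ⁅ u ⁆ → x ∈ B′ ∪ ⁅ w ⁆
  case x∈K (inj₁ x∈B) = p⊆p∪q _ (breaker-within r x∈K x∈B)
  case x∈K (inj₂ x∈⁅u⁆) with refl ← x∈⁅y⁆⇒x≡y u x∈⁅u⁆ = u-covered x∈K

module Lift {K H : Hypergraph n} (K⊑H : SubHypergraph K H) where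
  open SubHypergraph K⊑H

  makerHasWon-lift : (∀ {x} → x ∈ V K → x ∈ M′ → x ∈ M) → MakerHasWon K M′ → MakerHasWon H M
  makerHasWon-lift M′⊆M won′ =
    let e , e∈K , e⊆M′ = find won′
    in lose (edges⊆ e∈K) λ x∈e → M′⊆M (All.lookup (edges-in-V K) e∈K x∈e) (e⊆M′ x∈e)

  breakerHasWon-restrict : (∀ {x} → x ∈ V K → x ∈ B → x ∈ B′) → BreakerHasWon H B → BreakerHasWon K B′
  breakerHasWon-restrict {B = B} B⊆B′ breakerWon = All.tabulate λ {e} e∈K →
    let x , x∈e∩B = All.lookup breakerWon (edges⊆ e∈K)
        x∈e , x∈B = x∈p∩q⁻ e B x∈e∩B
    in x , x∈p∩q⁺ (x∈e , B⊆B′ (All.lookup (edges-in-V K) e∈K x∈e) x∈B)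

  free-lift : ∀ {v} → AsGoodOn K M B M′ B′ → Free K M′ B′ v → Free H M B v
  free-lift r (v∈K , v∉M′ , v∉B′) =
    vertices⊆ v∈K , v∉M′ ∘ to (makers-agree r v∈K) , v∉B′ ∘ breaker-within r v∈K

  winᴹ-lift : AsGoodOn K M B M′ B′ → Winᴹ K m M′ B′ → Winᴹ H m M B
  winᴮ-lift : AsGoodOn K M B M′ B′ → Winᴮ K m M′ B′ → Winᴮ H m M B

  winᴹ-lift r (won won′) = won (makerHasWon-lift (from ∘ makers-agree r) won′)
  winᴹ-lift r (play ¬breakerWon′ v-free′ win′) =
    play (¬breakerWon′ ∘ breakerHasWon-restrict (breaker-within r)) (free-lift r v-free′)
         (winᴮ-lift (AsGoodOn-maker-move r) win′)

  winᴮ-lift r (won won′) = won (makerHasWon-lift (from ∘ makers-agree r) won′)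
  winᴮ-lift {M = M} {B} {M′} {B′} {m} r (respond ¬breakerWon′ wins′) =
    respond (¬breakerWon′ ∘ breakerHasWon-restrict (breaker-within r)) response
    where
    -- A Breaker move that is not a free vertex of K is answered as if Breaker had
    -- taken an arbitrary free vertex w of K.
    response : ∀ {u} → Free H M B u → Winᴹ H m M (B ∪ ⁅ u ⁆)
    response {u} (_ , u∉M , _) with free? K M′ B′ u
    ... | yes u-free′ = winᴹ-lift (AsGoodOn-breaker-move r λ _ → x∈p∪q⁺ (inj₂ (x∈⁅x⁆ u))) (wins′ u-free′)
    ... | no ¬u-free′ with makerHasWon? K M′
    ...   | yes won′ = won (makerHasWon-lift (from ∘ makers-agree r) won′)
    ...   | no ¬won′ =
      let w , w-free′ = undecided⇒free K ¬won′ ¬breakerWon′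
      in winᴹ-lift (AsGoodOn-breaker-move r (p⊆p∪q _ ∘ held-by-breaker)) (wins′ w-free′)
      where
      held-by-breaker : u ∈ V K → u ∈ B′
      held-by-breaker u∈K = decidable-stable (u ∈? B′) λ u∉B′ →
        ¬u-free′ (u∈K , u∉M ∘ from (makers-agree r u∈K) , u∉B′)

open Lift using (makerHasWon-lift; breakerHasWon-restrict; free-lift; winᴹ-lift)

breakerHasWon-mono : (K : Hypergraph n) → B ⊆ B′ → BreakerHasWon K B → BreakerHasWon K B′
breakerHasWon-mono K B⊆B′ =
  breakerHasWon-restrict (SubHypergraph-refl K) λ _ → B⊆B′

winᴹ-fewer-breaker : (K : Hypergraph n) → B ⊆ B′ → Winᴹ K m M B′ → Winᴹ K m M B
winᴹ-fewer-breaker K B⊆B′ =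
  winᴹ-lift (SubHypergraph-refl K)
    record { makers-agree = λ _ → mk⇔ id id ; breaker-within = λ _ → B⊆B′ }

winᴹ-forget-outside : ∀ (K : Hypergraph n) {v} → v ∉ V K → Winᴹ K m (M ∪ ⁅ v ⁆) B → Winᴹ K m M B
winᴹ-forget-outside K v∉K = winᴹ-lift (SubHypergraph-refl K) record
  { makers-agree = λ x∈K → mk⇔ (p⊆p∪q _) (x∈p∪⁅y⁆⇒x∈p λ { refl → v∉K x∈K })
  ; breaker-within = λ _ → id }

winᴹ-ignore-outside : ∀ {K H : Hypergraph n} {u} → SubHypergraph K H → u ∉ V K →
                      Winᴹ K m M B → Winᴹ H m M (B ∪ ⁅ u ⁆)
winᴹ-ignore-outside K⊑H u∉K = winᴹ-lift K⊑H record
  { makers-agree = λ _ → mk⇔ id id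
  ; breaker-within = λ x∈K → x∈p∪⁅y⁆⇒x∈p λ { refl → u∉K x∈K } }

winᴹ-suc : ∀ {H : Hypergraph n} → Winᴹ H m M B → Winᴹ H (suc m) M B
winᴮ-suc : ∀ {H : Hypergraph n} → Winᴮ H m M B → Winᴮ H (suc m) M B
winᴹ-suc (won makerWon) = won makerWon
winᴹ-suc (play ¬breakerWon v-free win) = play ¬breakerWon v-free (winᴮ-suc win)
winᴮ-suc (won makerWon) = won makerWon
winᴮ-suc (respond ¬breakerWon wins) = respond ¬breakerWon λ v-free → winᴹ-suc (wins v-free)

winᴮ⇒winᴹ : (H : Hypergraph n) → Winᴮ H m M B → Winᴹ H m M B
winᴮ⇒winᴹ H (won makerWon) = won makerWon
winᴮ⇒winᴹ {M = M} H (respond ¬breakerWon wins) with makerHasWon? H M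
... | yes makerWon = won makerWon
... | no ¬makerWon = let _ , v-free = undecided⇒free H ¬makerWon ¬breakerWon
                     in winᴹ-fewer-breaker H (p⊆p∪q _) (wins v-free)

wMM≤wMB : (H : Hypergraph n) → wMM H ≤∞ wMB H
wMM≤wMB H = ≤∞-by-fin (from (wMM-≤⇔ H) ∘ winᴮ⇒winᴹ H ∘ to (wMB-≤⇔ H))

winᴮ-from-disjoint-wins : ∀ {K₀ K₁ H : Hypergraph n} → SubHypergraph K₀ H → SubHypergraph K₁ H →
                        (∀ {x} → x ∈ V K₀ → x ∉ V K₁) → Winᴹ K₀ m M B → Winᴹ K₁ m M B → Winᴮ H m M B
winᴮ-from-disjoint-wins K₀⊑H _ _ (won makerWon) _ = won (makerHasWon-lift K₀⊑H (λ _ → id) makerWon)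
winᴮ-from-disjoint-wins {m = m} {M} {B} {K₀} {H = H}
                        K₀⊑H K₁⊑H disjoint win₀@(play ¬breakerWon _ _) win₁ =
  respond (¬breakerWon ∘ breakerHasWon-restrict K₀⊑H (λ _ → id)) response
  where
  response : ∀ {u} → Free H M B u → Winᴹ H m M (B ∪ ⁅ u ⁆)
  response {u} _ with u ∈? V K₀
  ... | yes u∈K₀ = winᴹ-ignore-outside K₁⊑H (disjoint u∈K₀) win₁
  ... | no u∉K₀ = winᴹ-ignore-outside K₀⊑H u∉K₀ win₀

Empty-∩-maker-move : ∀ {v} → Empty (M ∩ B) → v ∉ B → Empty ((M ∪ ⁅ v ⁆) ∩ B)
Empty-∩-maker-move {M = M} {B} {v} disjoint v∉B (x , x∈) =
  let x∈M∪v , x∈B = x∈p∩q⁻ (M ∪ ⁅ v ⁆) B x∈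
  in disjoint (x , x∈p∩q⁺ (x∈p∪⁅y⁆⇒x∈p (λ { refl → v∉B x∈B }) x∈M∪v , x∈B))

Empty-∩-breaker-move : ∀ {v} → Empty (M ∩ B) → v ∉ M → Empty (M ∩ (B ∪ ⁅ v ⁆))
Empty-∩-breaker-move {M = M} {B} {v} disjoint v∉M (x , x∈) =
  let x∈M , x∈B∪v = x∈p∩q⁻ M (B ∪ ⁅ v ⁆) x∈
  in disjoint (x , x∈p∩q⁺ (x∈M , x∈p∪⁅y⁆⇒x∈p (λ { refl → v∉M x∈M }) x∈B∪v))

winᴹ⇒¬breakerHasWon : ∀ {H : Hypergraph n} → Empty (M ∩ B) → Winᴹ H m M B → ¬ BreakerHasWon H B
winᴹ⇒¬breakerHasWon {H = H} disjoint (won makerWon) = makerHasWon⇒¬breakerHasWon H disjoint makerWon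
winᴹ⇒¬breakerHasWon _ (play ¬breakerWon _ _) = ¬breakerWon

winᴮ⇒¬breakerHasWon : ∀ {H : Hypergraph n} → Empty (M ∩ B) → Winᴮ H m M B → ¬ BreakerHasWon H B
winᴮ⇒¬breakerHasWon {H = H} disjoint (won makerWon) = makerHasWon⇒¬breakerHasWon H disjoint makerWon
winᴮ⇒¬breakerHasWon _ (respond ¬breakerWon _) = ¬breakerWon

∀⊎∃ : ∀ {n} {P Q : Fin n → Set} → (∀ i → P i ⊎ Q i) → (∀ i → P i) ⊎ ∃ Q
∀⊎∃ {zero} _ = inj₁ λ ()
∀⊎∃ {suc n} P⊎Q with P⊎Q zero | ∀⊎∃ (P⊎Q ∘ suc)
... | inj₂ q | _ = inj₂ (zero , q)
... | inj₁ _ | inj₂ (i , q) = inj₂ (suc i , q)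
... | inj₁ p | inj₁ ps = inj₁ λ { zero → p ; (suc i) → ps i }

-- Components

open IsComponent using (sub; class; edges)

IsComponent⇒SubHypergraph : ∀ {H K : Hypergraph n} → IsComponent H K → SubHypergraph K H
IsComponent⇒SubHypergraph K-comp = record
  { vertices⊆ = sub K-comp ; edges⊆ = λ {e} e∈K → proj₁ (proj₁ (edges K-comp e) e∈K) }

components-meet⇒⊆ : ∀ {H K K′ : Hypergraph n} {x} → IsComponent H K → IsComponent H K′ →
                    x ∈ V K → x ∈ V K′ → V K ⊆ V K′
components-meet⇒⊆ K-comp K′-comp x∈K x∈K′ y∈K = proj₂ (class K′-comp x∈K′) (proj₁ (class K-comp x∈K) y∈K)

components-meet⇒≡ : ∀ {H K K′ : Hypergraph n} {x} → IsComponent H K → IsComponent H K′ →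
                    x ∈ V K → x ∈ V K′ → V K ≡ V K′
components-meet⇒≡ K-comp K′-comp x∈K x∈K′ =
  ⊆-antisym (components-meet⇒⊆ K-comp K′-comp x∈K x∈K′) (components-meet⇒⊆ K′-comp K-comp x∈K′ x∈K)

edge∈component : ∀ {H K : Hypergraph n} {e x} → IsComponent H K → e ∈ₗ E H → x ∈ e → x ∈ V K → e ∈ₗ E K
edge∈component {H = H} {e = e} K-comp e∈H x∈e x∈K = proj₂ (edges K-comp e) (e∈H , λ y∈e →
  proj₂ (class K-comp x∈K) (step e e∈H x∈e y∈e (here (All.lookup (edges-in-V H) e∈H y∈e))))

module Decomposition {N} (H : Hypergraph n) (Hs : Fin N → Hypergraph n)
  (components : ∀ i → IsComponent H (Hs i))
  (distinct : ∀ i j → i ≢ j → V (Hs i) ≢ V (Hs j))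
  (covering : ∀ v → v ∈ V H → ∃ λ i → v ∈ V (Hs i)) where

  component⊑ : ∀ i → SubHypergraph (Hs i) H
  component⊑ i = IsComponent⇒SubHypergraph (components i)

  vertex-disjoint : ∀ {i j x} → i ≢ j → x ∈ V (Hs i) → x ∉ V (Hs j)
  vertex-disjoint i≢j x∈i x∈j =
    distinct _ _ i≢j (components-meet⇒≡ (components _) (components _) x∈i x∈j)

  makerHasWon-in-component : MakerHasWon H M → ∃ λ i → MakerHasWon (Hs i) M
  makerHasWon-in-component makerWon =
    let e , e∈H , e⊆M = find makerWon
        x , x∈e = All.lookup (edges-nonempty H) e∈H
        i , x∈i = covering x (All.lookup (edges-in-V H) e∈H x∈e)
    in i , lose (edge∈component (components i) e∈H x∈e x∈i) e⊆M

  Elsewhere : ℕ → Subset n → Subset n → Fin N → Set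
  Elsewhere m M B j = ∃ λ i → i ≢ j × Winᴹ (Hs i) m M B

  private
    wonIn : MakerHasWon H M → ∀ j → Winᴮ (Hs j) m M B ⊎ Elsewhere m M B j
    wonIn makerWon j with makerHasWon-in-component makerWon
    ... | i , won-i with i ≟ j
    ...   | yes refl = inj₁ (won won-i)
    ...   | no i≢j = inj₂ (i , i≢j , won won-i)

    relocate : ∀ {u} j → (∃ λ i → Winᴹ (Hs i) m M (B ∪ ⁅ u ⁆)) →
               Winᴹ (Hs j) m M (B ∪ ⁅ u ⁆) ⊎ Elsewhere m M B j
    relocate j (i , win-i) with i ≟ j
    ... | yes refl = inj₁ win-i
    ... | no i≢j = inj₂ (i , i≢j , winᴹ-fewer-breaker (Hs i) (p⊆p∪q _) win-i)

  winᴹ-restrict : Empty (M ∩ B) → Winᴹ H m M B → ∃ λ i → Winᴹ (Hs i) m M B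
  winᴮ-restrict : Empty (M ∩ B) → Winᴮ H m M B → ∀ j → Winᴮ (Hs j) m M B ⊎ Elsewhere m M B j

  winᴹ-restrict _ (won makerWon) = Product.map₂ won (makerHasWon-in-component makerWon)
  winᴹ-restrict disjoint (play {v = v} _ (v∈H , v∉M , v∉B) win) with covering v v∈H
  ... | j , v∈j with winᴮ-restrict (Empty-∩-maker-move disjoint v∉B) win j
  ...   | inj₁ win-j =
    j , play (winᴮ⇒¬breakerHasWon (Empty-∩-maker-move disjoint v∉B) win-j) (v∈j , v∉M , v∉B) win-j
  ...   | inj₂ (i , i≢j , win-i) =
    i , winᴹ-suc (winᴹ-forget-outside (Hs i) (vertex-disjoint (i≢j ∘ sym) v∈j) win-i)

  winᴮ-restrict _ (won makerWon) j = wonIn makerWon j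
  winᴮ-restrict {M = M} {B} {m} disjoint (respond ¬breakerWon wins) j
    with makerHasWon? H M | breakerHasWon? (Hs j) B
  ... | yes makerWon | _ = wonIn makerWon j
  ... | no ¬makerWon | yes breakerWon-j =
    let v , v-free@(_ , v∉M , _) = undecided⇒free H ¬makerWon ¬breakerWon
        disjoint′ = Empty-∩-breaker-move disjoint v∉M
    in inj₂ ([ (λ win-j → contradiction (breakerHasWon-mono (Hs j) (p⊆p∪q _) breakerWon-j)
                                        (winᴹ⇒¬breakerHasWon disjoint′ win-j)) , id ]′
              (relocate j (winᴹ-restrict disjoint′ (wins v-free))))
  ... | no _ | no ¬breakerWon-j =
    Sum.map (λ wins-j → respond ¬breakerWon-j λ {u} → wins-j u) proj₂ (∀⊎∃ response)
    where
    response : ∀ u → (Free (Hs j) M B u → Winᴹ (Hs j) m M (B ∪ ⁅ u ⁆)) ⊎ Elsewhere m M B j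
    response u with free? (Hs j) M B u
    ... | no ¬u-free = inj₁ (flip contradiction ¬u-free)
    ... | yes u-free@(_ , u∉M , _) =
      Sum.map₁ const (relocate j (winᴹ-restrict (Empty-∩-breaker-move disjoint u∉M)
                                                (wins (free-lift (component⊑ j) AsGoodOn-refl u-free))))

proposition2p3 : ∀ {n} (H : Hypergraph n) (k : ℕ) (Hs : Fin (suc (suc k)) → Hypergraph n) →
    (∀ i → IsComponent H (Hs i)) →
    (∀ i j → i ≢ j → V (Hs i) ≢ V (Hs j)) →
    (∀ v → v ∈ V H → ∃ λ i → v ∈ V (Hs i)) →
    (∀ i j → toℕ i ≤ toℕ j → wMM (Hs i) ≤∞ wMM (Hs j)) →
    (wMM H ≡ wMM (Hs zero)) × (wMM (Hs zero) ≤∞ wMB H) × (wMB H ≤∞ wMM (Hs (suc zero)))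
proposition2p3 {n} H k Hs components distinct covering sorted =
  ≤∞-antisym wMM-H≤wMM-H₁ wMM-H₁≤wMM-H , ≤∞-trans wMM-H₁≤wMM-H (wMM≤wMB H) , wMB-H≤wMM-H₂
  where
  open Decomposition H Hs components distinct covering
  H₁ H₂ : Hypergraph n
  H₁ = Hs zero
  H₂ = Hs (suc zero)
  nothing-played : Empty (∅ ∩ ∅)
  nothing-played (_ , x∈) = ∉⊥ (proj₁ (x∈p∩q⁻ ∅ ∅ x∈))
  wMM-H≤wMM-H₁ : wMM H ≤∞ wMM H₁
  wMM-H≤wMM-H₁ =
    ≤∞-by-fin (from (wMM-≤⇔ H) ∘ winᴹ-lift (component⊑ zero) AsGoodOn-refl ∘ to (wMM-≤⇔ H₁))
  wMM-H₁≤wMM-H : wMM H₁ ≤∞ wMM H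
  wMM-H₁≤wMM-H = ≤∞-by-fin λ wMM-H≤m →
    let i , win-i = winᴹ-restrict nothing-played (to (wMM-≤⇔ H) wMM-H≤m)
    in ≤∞-trans (sorted zero i z≤n) (from (wMM-≤⇔ (Hs i)) win-i)
  wMB-H≤wMM-H₂ : wMB H ≤∞ wMM H₂
  wMB-H≤wMM-H₂ = ≤∞-by-fin λ wMM-H₂≤m →
    let win₁ = to (wMM-≤⇔ H₁) (≤∞-trans (sorted zero (suc zero) z≤n) wMM-H₂≤m)
        win₂ = to (wMM-≤⇔ H₂) wMM-H₂≤m
    in from (wMB-≤⇔ H) (winᴮ-from-disjoint-wins (component⊑ zero) (component⊑ (suc zero))
                                                 (vertex-disjoint λ ()) win₁ win₂)
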